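{- Let $G$ and $H$ be finite simple graphs such that $G$ is a subgraph of $H$. If $G\in\mathcal{U}$, then $H\in\mathcal{U}$.
   Context: Let $V$ be a finite set of Boolean variables. A clause is a disjunction of literals from $V\cup\neg V\cup\{\top,\bot\}$; a CNF is a conjunction of clauses; it is reduced if unchanged under the rules $x\vee\top=\top$, $x\vee\bot=x$, $x\wedge\top=x$, $x\wedge\bot=\bot$, $x\vee x=x$, $x\wedge x=x$, $\neg\neg x=x$, $x\vee\neg x=\top$. A nontrivial reduced 2-CNF is a reduced CNF other than $\top,\bot$ all of whose clauses have exactly two literals. With $|x|=|\neg x|=x$, its associated multigraph has as vertices the variables occurring in it and one edge $\{|a|,|b|\}$ per clause $(a\vee b)$. The 2-CNF is simple if this multigraph has no multiple edges, in which case the graph is denoted $\mathcal{G}(S)$. $\mathcal{U}$ is the family of graphs $\mathcal{G}(S)$ with $S$ an unsatisfiable simple 2-CNF (unsatisfiable: no truth assignment makes it true). -}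

module Defs where

open import Data.Nat using (ℕ)
open import Data.Bool using (Bool; true; false; not; _∨_)
open import Data.Product using (_×_; _,_; proj₁; proj₂; Σ; ∃)
open import Data.Sum using (_⊎_)
open import Data.List using (List; []; _∷_; map)
open import Data.List.Relation.Unary.All using (All)
open import Data.List.Relation.Unary.AllPairs using (AllPairs)
open import Data.List.Membership.Propositional using (_∈_)
open import Relation.Binary.PropositionalEquality using (_≡_; _≢_)
open import Relation.Nullary using (¬_)

-- The vertex set of a graph is
-- the set of endpoints of its edges (matching 𝒢(S), whose vertices are
-- exactly the variables occurring in S).  Repeated entries of the list
-- denote the same edge: a graph is its (symmetric) adjacency relation.

record Graph : Set where
  constructor mkGraph
  field
    edges    : List (ℕ × ℕ)
    loopless : All (λ e → proj₁ e ≢ proj₂ e) edges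
open Graph public

Adj : Graph → ℕ → ℕ → Set
Adj G u v = ((u , v) ∈ edges G) ⊎ ((v , u) ∈ edges G)

_⊆G_ : Graph → Graph → Set
G ⊆G H = ∀ u v → Adj G u v → Adj H u v

data Literal : Set where
  pos : ℕ → Literal
  neg : ℕ → Literal

∣_∣ : Literal → ℕ
∣ pos x ∣ = x
∣ neg x ∣ = x

Clause : Set
Clause = Literal × Literal

CNF2 : Set
CNF2 = List Clause

evalLit : (ℕ → Bool) → Literal → Bool
evalLit ρ (pos x) = ρ x
evalLit ρ (neg x) = not (ρ x)

evalClause : (ℕ → Bool) → Clause → Bool
evalClause ρ (a , b) = evalLit ρ a ∨ evalLit ρ b

Satisfies : (ℕ → Bool) → CNF2 → Set
Satisfies ρ S = All (λ c → evalClause ρ c ≡ true) S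

Unsatisfiable : CNF2 → Set
Unsatisfiable S = ∀ (ρ : ℕ → Bool) → ¬ Satisfies ρ S

SameEdge : Clause → Clause → Set
SameEdge (a , b) (c , d) =
  ((∣ a ∣ ≡ ∣ c ∣) × (∣ b ∣ ≡ ∣ d ∣)) ⊎ ((∣ a ∣ ≡ ∣ d ∣) × (∣ b ∣ ≡ ∣ c ∣))

-- S is a nontrivial reduced simple 2-CNF:
--  * nontrivial: S has at least one clause (S ≠ ⊤; S ≠ ⊥ since no clause
--    is empty and no literal is ⊤/⊥ — every clause has two variable literals);
--  * reduced: within a clause the two literals are neither equal (x ∨ x) nor
--    complementary (x ∨ ¬x), i.e. they have distinct variables; no clause is
--    repeated (implied by simplicity);
--  * simple: no two clauses give the same edge {|a|,|b|}.
NonEmpty : CNF2 → Set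
NonEmpty [] = Data.Empty.⊥ where import Data.Empty
NonEmpty (_ ∷ _) = Data.Unit.⊤ where import Data.Unit

SimpleReduced2CNF : CNF2 → Set
SimpleReduced2CNF S =
  NonEmpty S ×
  All (λ c → ∣ proj₁ c ∣ ≢ ∣ proj₂ c ∣) S ×
  AllPairs (λ c d → ¬ SameEdge c d) S

𝒢-edges : CNF2 → List (ℕ × ℕ)
𝒢-edges S = map (λ c → ∣ proj₁ c ∣ , ∣ proj₂ c ∣) S

InU : Graph → Set
InU H = Σ CNF2 λ S →
  SimpleReduced2CNF S × Unsatisfiable S ×
  (∀ u v → ((u , v) ∈ 𝒢-edges S ⊎ (v , u) ∈ 𝒢-edges S) → Adj H u v) ×
  (∀ u v → Adj H u v → ((u , v) ∈ 𝒢-edges S ⊎ (v , u) ∈ 𝒢-edges S))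

-- Adding clauses to an unsatisfiable 2-CNF keeps it unsatisfiable.  So from an
-- unsatisfiable simple S with 𝒢(S) = G, add the clause (x ∨ y) for every edge
-- {x, y} of H that S does not yet cover; the result is still simple and
-- reduced, and its graph is exactly H because G ⊆ H.
module Submission where

open import Defs
open import Data.Nat using (ℕ)
open import Data.Nat.Properties using (_≟_)
open import Data.Product using (_×_; _,_; proj₁; proj₂)
open import Data.Sum using (_⊎_; inj₁; inj₂; [_,_])
open import Data.List using (List; []; _∷_)
open import Data.List.Relation.Unary.All using (All; []; _∷_; tabulate; lookup)
open import Data.List.Relation.Unary.All.Properties using (¬Any⇒All¬; anti-mono)
open import Data.List.Relation.Unary.Any using (Any; here; there; any?)
open import Data.List.Relation.Unary.AllPairs using (_∷_)
open import Data.List.Relation.Binary.Subset.Propositional using (_⊆_)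
open import Data.List.Relation.Binary.Subset.Propositional.Properties
  using (⊆-refl; ⊆-trans; xs⊆x∷xs; map⁺)
open import Data.List.Membership.Propositional using (_∈_; find)
open import Data.List.Membership.Propositional.Properties using (∈-map⁺; ∈-map⁻)
open import Data.Unit using (tt)
open import Function using (_∘_)
open import Relation.Binary.PropositionalEquality using (_≢_; refl)
open import Relation.Nullary using (Dec; yes; no)
open import Relation.Nullary.Decidable using (_×-dec_; _⊎-dec_)

𝒢-Adj : CNF2 → ℕ → ℕ → Set
𝒢-Adj S u v = (u , v) ∈ 𝒢-edges S ⊎ (v , u) ∈ 𝒢-edges S

ClauseIn : Graph → Clause → Set
ClauseIn H c = Adj H ∣ proj₁ c ∣ ∣ proj₂ c ∣

Adj-sym : ∀ H {u v} → Adj H u v → Adj H v u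
Adj-sym H = [ inj₂ , inj₁ ]

𝒢-Adj-sym : ∀ S {u v} → 𝒢-Adj S u v → 𝒢-Adj S v u
𝒢-Adj-sym S = [ inj₂ , inj₁ ]

𝒢-Adj-mono : ∀ {S T u v} → S ⊆ T → 𝒢-Adj S u v → 𝒢-Adj T u v
𝒢-Adj-mono S⊆T (inj₁ uv) = inj₁ (map⁺ _ S⊆T uv)
𝒢-Adj-mono S⊆T (inj₂ vu) = inj₂ (map⁺ _ S⊆T vu)

𝒢-Adj-clause : ∀ {S} c → c ∈ S → 𝒢-Adj S ∣ proj₁ c ∣ ∣ proj₂ c ∣
𝒢-Adj-clause _ c∈S = inj₁ (∈-map⁺ _ c∈S)

𝒢-Adj⇒Adj : ∀ H {S} → All (ClauseIn H) S → ∀ u v → 𝒢-Adj S u v → Adj H u v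
𝒢-Adj⇒Adj H {S} inH _ _ = [ directed , Adj-sym H ∘ directed ]
  where
  directed : ∀ {u v} → (u , v) ∈ 𝒢-edges S → Adj H u v
  directed uv with ∈-map⁻ _ uv
  ... | c , c∈S , refl = lookup inH c∈S

Unsatisfiable-⊆ : ∀ {S T} → S ⊆ T → Unsatisfiable S → Unsatisfiable T
Unsatisfiable-⊆ S⊆T unsatS ρ satT = unsatS ρ (anti-mono S⊆T satT)

sameEdge? : (c d : Clause) → Dec (SameEdge c d)
sameEdge? (a , b) (c , d) =
  ((∣ a ∣ ≟ ∣ c ∣) ×-dec (∣ b ∣ ≟ ∣ d ∣)) ⊎-dec ((∣ a ∣ ≟ ∣ d ∣) ×-dec (∣ b ∣ ≟ ∣ c ∣))

sameEdge⇒𝒢-Adj : ∀ c S → Any (SameEdge c) S → 𝒢-Adj S ∣ proj₁ c ∣ ∣ proj₂ c ∣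
sameEdge⇒𝒢-Adj (a , b) S p with find p
... | d , d∈S , inj₁ (a≡ , b≡) rewrite a≡ | b≡ = 𝒢-Adj-clause d d∈S
... | d , d∈S , inj₂ (a≡ , b≡) rewrite a≡ | b≡ = 𝒢-Adj-sym S (𝒢-Adj-clause d d∈S)

addClause : Clause → CNF2 → CNF2
addClause c S with any? (sameEdge? c) S
... | yes _ = S
... | no _  = c ∷ S

⊆-addClause : ∀ c S → S ⊆ addClause c S
⊆-addClause c S with any? (sameEdge? c) S
... | yes _ = ⊆-refl
... | no _  = xs⊆x∷xs S c

addClause-All : ∀ {P : Clause → Set} {c S} → P c → All P S → All P (addClause c S)
addClause-All {c = c} {S} pc pS with any? (sameEdge? c) S
... | yes _ = pS
... | no _  = pc ∷ pS

addClause-covers : ∀ c S → 𝒢-Adj (addClause c S) ∣ proj₁ c ∣ ∣ proj₂ c ∣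
addClause-covers c S with any? (sameEdge? c) S
... | yes p = sameEdge⇒𝒢-Adj c S p
... | no _  = 𝒢-Adj-clause c (here refl)

addClause-simple : ∀ {c S} → ∣ proj₁ c ∣ ≢ ∣ proj₂ c ∣ →
                   SimpleReduced2CNF S → SimpleReduced2CNF (addClause c S)
addClause-simple {c} {S} c-reduced (nonEmpty , reduced , simple) with any? (sameEdge? c) S
... | yes _ = nonEmpty , reduced , simple
... | no c∉ = tt , c-reduced ∷ reduced , ¬Any⇒All¬ S c∉ ∷ simple

positiveClause : ℕ × ℕ → Clause
positiveClause e = pos (proj₁ e) , pos (proj₂ e)

addEdges : List (ℕ × ℕ) → CNF2 → CNF2
addEdges []       S = S
addEdges (e ∷ es) S = addClause (positiveClause e) (addEdges es S)

⊆-addEdges : ∀ es S → S ⊆ addEdges es S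
⊆-addEdges []       S = ⊆-refl
⊆-addEdges (e ∷ es) S = ⊆-trans (⊆-addEdges es S) (⊆-addClause _ _)

addEdges-All : ∀ {P : Clause → Set} {es S} →
               All (λ e → P (positiveClause e)) es → All P S → All P (addEdges es S)
addEdges-All []         pS = pS
addEdges-All (pe ∷ pes) pS = addClause-All pe (addEdges-All pes pS)

addEdges-covers : ∀ {e es} S → e ∈ es → 𝒢-Adj (addEdges es S) (proj₁ e) (proj₂ e)
addEdges-covers {es = e ∷ es} S (here refl) = addClause-covers (positiveClause e) (addEdges es S)
addEdges-covers {es = _ ∷ es} S (there e∈es) =
  𝒢-Adj-mono (⊆-addClause _ _) (addEdges-covers S e∈es)

addEdges-simple : ∀ {es S} → All (λ e → proj₁ e ≢ proj₂ e) es →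
                  SimpleReduced2CNF S → SimpleReduced2CNF (addEdges es S)
addEdges-simple []                simpleS = simpleS
addEdges-simple (e-loopless ∷ ls) simpleS = addClause-simple e-loopless (addEdges-simple ls simpleS)

theorem5 : (G H : Graph) → G ⊆G H → InU G → InU H
theorem5 G H G⊆H (S , simpleS , unsatS , S⇒G , _) =
  T , addEdges-simple (loopless H) simpleS
    , Unsatisfiable-⊆ (⊆-addEdges E S) unsatS
    , 𝒢-Adj⇒Adj H T-in-H
    , H⇒T
  where
  E : List (ℕ × ℕ)
  E = edges H
  T : CNF2
  T = addEdges E S
  T-in-H : All (ClauseIn H) T
  T-in-H = addEdges-All (tabulate inj₁)
             (tabulate λ {c} c∈S → G⊆H _ _ (S⇒G _ _ (𝒢-Adj-clause c c∈S)))
  H⇒T : ∀ u v → Adj H u v → 𝒢-Adj T u v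
  H⇒T u v (inj₁ uv) = addEdges-covers S uv
  H⇒T u v (inj₂ vu) = 𝒢-Adj-sym T (addEdges-covers S vu)
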